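{- For every positive integer $x$ and every positive integer $n$, \[ H^{(n)}(x)=\prod_{k=1}^{x}k^{\,k\,P_{n-1}((x-k)+1)}. \]
   Context: For integers $r\ge 0$ and $m\ge 1$, the $r$-simplex (figurate) number is $P_r(m)=\binom{m+r-1}{r}$ (so $P_0(m)=1$). The generalized ($n$th-degree) hyperfactorial is defined for positive integers $x$ by $H^{(1)}(x)=\prod_{k=1}^{x}k^{k}$ (the usual hyperfactorial) and, for $n\ge 2$, $H^{(n)}(x)=\prod_{k=1}^{x}H^{(n-1)}(k)$. -}

module Defs where

open import Data.Nat using (ℕ; zero; suc; _+_; _*_; _∸_; _^_)
open import Data.Nat.Combinatorics using (_C_)

prodFrom1 : ℕ → (ℕ → ℕ) → ℕ
prodFrom1 zero    f = 1
prodFrom1 (suc x) f = prodFrom1 x f * f (suc x)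

P : ℕ → ℕ → ℕ
P r m = (m + r ∸ 1) C r

-- generalized hyperfactorial H^(n)(x), n ≥ 1; index n is given as suc n'
-- H (suc zero) x = ∏ k^k ; H (suc (suc n)) x = ∏ H (suc n) k
-- H zero is a junk value (unused).
H : ℕ → ℕ → ℕ
H zero          x = 1
H (suc zero)    x = prodFrom1 x (λ k → k ^ k)
H (suc (suc n)) x = prodFrom1 x (λ k → H (suc n) k)

{-# OPTIONS --safe #-}
module Submission where

open import Defs
open import Data.Nat using (ℕ; zero; suc; _+_; _*_; _∸_; _^_; _≥_; _≤_)
open import Data.Nat.Properties
open import Data.Nat.Combinatorics using (_C_; nCn≡1; nCk+nC[k+1]≡[n+1]C[k+1])
open import Algebra.Properties.CommutativeSemigroup *-commutativeSemigroup using (interchange)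
open import Relation.Binary.PropositionalEquality

-- H⁽ᵐ⁺¹⁾ arises from the weights k ^ k by m successive partial products. Tracking
-- the exponent of each weight, one partial product replaces C(x−k+m, m) by its
-- partial sum over x, which by Pascal's rule (the hockey-stick identity) is
-- C(x−k+m+1, m+1); and C(x−k+m, m) is the simplex number P_m(x−k+1).

prodFrom1-cong : ∀ x {f g} → (∀ k → k ≤ x → f k ≡ g k) → prodFrom1 x f ≡ prodFrom1 x g
prodFrom1-cong zero    f≗g = refl
prodFrom1-cong (suc x) f≗g =
  cong₂ _*_ (prodFrom1-cong x (λ k k≤x → f≗g k (m≤n⇒m≤1+n k≤x))) (f≗g (suc x) ≤-refl)

prodFrom1-distrib-* : ∀ x f g →
  prodFrom1 x (λ k → f k * g k) ≡ prodFrom1 x f * prodFrom1 x g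
prodFrom1-distrib-* zero    f g = refl
prodFrom1-distrib-* (suc x) f g =
  trans (cong (_* (f (suc x) * g (suc x))) (prodFrom1-distrib-* x f g))
        (interchange (prodFrom1 x f) (prodFrom1 x g) (f (suc x)) (g (suc x)))

simplexExp : ℕ → ℕ → ℕ → ℕ
simplexExp m x k = (x ∸ k + m) C m

simplexExp-diag : ∀ m k → simplexExp m k k ≡ 1
simplexExp-diag m k = trans (cong (λ d → (d + m) C m) (n∸n≡0 k)) (nCn≡1 m)

simplexExp-pascal : ∀ m y {k} → k ≤ y →
  simplexExp (suc m) (suc y) k ≡ simplexExp (suc m) y k + simplexExp m (suc y) k
simplexExp-pascal m y {k} k≤y = begin
    (suc y ∸ k + suc m) C suc m
  ≡⟨ cong (λ d → (d + suc m) C suc m) (+-∸-assoc 1 k≤y) ⟩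
    suc (y ∸ k + suc m) C suc m
  ≡⟨ nCk+nC[k+1]≡[n+1]C[k+1] (y ∸ k + suc m) m ⟨
    (y ∸ k + suc m) C m + (y ∸ k + suc m) C suc m
  ≡⟨ +-comm ((y ∸ k + suc m) C m) _ ⟩
    (y ∸ k + suc m) C suc m + (y ∸ k + suc m) C m
  ≡⟨ cong (λ n → (y ∸ k + suc m) C suc m + n C m)
          (trans (+-suc (y ∸ k) m) (cong (_+ m) (sym (+-∸-assoc 1 k≤y)))) ⟩
    (y ∸ k + suc m) C suc m + (suc y ∸ k + m) C m
  ∎
  where open ≡-Reasoning

simplexExp≡P : ∀ m x k → simplexExp m x k ≡ P m (x ∸ k + 1)
simplexExp≡P m x k =
  cong (λ n → (n ∸ 1) C m) (sym (trans (+-assoc (x ∸ k) 1 m) (+-suc (x ∸ k) m)))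

prodFrom1-simplexPowers-step : ∀ (w : ℕ → ℕ) m x →
  prodFrom1 x (λ j → prodFrom1 j (λ k → w k ^ simplexExp m j k)) ≡
  prodFrom1 x (λ k → w k ^ simplexExp (suc m) x k)
prodFrom1-simplexPowers-step w m zero    = refl
prodFrom1-simplexPowers-step w m (suc y) = begin
    prodFrom1 y (λ j → prodFrom1 j (λ k → w k ^ simplexExp m j k)) * (row * corner m)
  ≡⟨ cong₂ (λ u v → u * (row * v)) (prodFrom1-simplexPowers-step w m y) cornerExponent ⟩
    prodFrom1 y (term (suc m) y) * (row * corner (suc m))
  ≡⟨ *-assoc (prodFrom1 y (term (suc m) y)) row (corner (suc m)) ⟨
    prodFrom1 y (term (suc m) y) * row * corner (suc m)
  ≡⟨ cong (_* corner (suc m)) (prodFrom1-distrib-* y (term (suc m) y) (term m (suc y))) ⟨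
    prodFrom1 y (λ k → term (suc m) y k * term m (suc y) k) * corner (suc m)
  ≡⟨ cong (_* corner (suc m)) (prodFrom1-cong y pascal) ⟩
    prodFrom1 y (term (suc m) (suc y)) * corner (suc m)
  ∎
  where
  open ≡-Reasoning
  term : ℕ → ℕ → ℕ → ℕ
  term m′ x k = w k ^ simplexExp m′ x k
  row : ℕ
  row = prodFrom1 y (term m (suc y))
  corner : ℕ → ℕ
  corner m′ = term m′ (suc y) (suc y)
  cornerExponent : corner m ≡ corner (suc m)
  cornerExponent = cong (w (suc y) ^_)
    (trans (simplexExp-diag m (suc y)) (sym (simplexExp-diag (suc m) (suc y))))
  pascal : ∀ k → k ≤ y → term (suc m) y k * term m (suc y) k ≡ term (suc m) (suc y) k
  pascal k k≤y =
    trans (sym (^-distribˡ-+-* (w k) (simplexExp (suc m) y k) (simplexExp m (suc y) k)))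
          (cong (w k ^_) (sym (simplexExp-pascal m y k≤y)))

H-simplexPowers : ∀ m x → H (suc m) x ≡ prodFrom1 x (λ k → (k ^ k) ^ simplexExp m x k)
H-simplexPowers zero    x = prodFrom1-cong x (λ k _ → sym (^-identityʳ (k ^ k)))
H-simplexPowers (suc m) x =
  trans (prodFrom1-cong x (λ j _ → H-simplexPowers m j))
        (prodFrom1-simplexPowers-step (λ k → k ^ k) m x)

theorem4p2 : (x n : ℕ) → x ≥ 1 → n ≥ 1 →
    H n x ≡ prodFrom1 x (λ k → k ^ (k * P (n ∸ 1) ((x ∸ k) + 1)))
theorem4p2 x (suc m) _ _ = trans (H-simplexPowers m x) (prodFrom1-cong x exponent)
  where
  exponent : ∀ k → k ≤ x → (k ^ k) ^ simplexExp m x k ≡ k ^ (k * P m (x ∸ k + 1))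
  exponent k _ = trans (^-*-assoc k k _) (cong (λ e → k ^ (k * e)) (simplexExp≡P m x k))
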